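{- For every static binary search tree $T$ on $\{1,\ldots,n\}$ and every search sequence $X = x_1,\ldots,x_m$ over $\{1,\ldots,n\}$, $$\sum_{i=1}^m r(T, x_{i-1}, x_i) = \Omega\left(\min_W \left\{\sum_{i=1}^m \lg \frac{\sum_{k=\min(x_{i-1},x_i)}^{\max(x_{i-1},x_i)} w_k}{\min(w_{x_{i-1}}, w_{x_i})}\right\}\right),$$ where the minimum ranges over all weight vectors $W=(w_1,\ldots,w_n)$ of positive reals and the implied constant is absolute.
   Context: $d_T$ is the depth in $T$ (root at depth $0$), $\mathrm{LCA}_T$ the lowest common ancestor, and $r(T,i,j) = d_T(i)+d_T(j)-2d_T(\mathrm{LCA}_T(i,j))$. $x_0$ is the root of $T$ (the first search starts from the root). $\lg$ is the base-2 logarithm. -}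

module Defs where

open import Data.Nat using (ℕ; zero; suc; _+_; _*_; _∸_; _^_; _≤_; _<ᵇ_)
open import Data.Nat.Base using (_⊓_; _⊔_)
open import Data.Bool using (Bool; true; false; if_then_else_; _∧_)
open import Data.List using (List; []; _∷_; map; upTo; zip)
open import Data.Nat.ListAction using (sum; product)
open import Data.Product using (_×_; _,_)
open import Relation.Binary.PropositionalEquality using (_≡_)

data Tree : Set where
  leaf : Tree
  node : Tree → ℕ → Tree → Tree

inorder : Tree → List ℕ
inorder leaf = []
inorder (node l k r) = inorder l Data.List.++ (k ∷ inorder r)

keys : ℕ → List ℕ
keys n = map suc (upTo n)

IsBSTOn : ℕ → Tree → Set
IsBSTOn n T = inorder T ≡ keys n

-- Root key (x_0).  The leaf case only arises for n = 0 (no searches possible).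
root : Tree → ℕ
root leaf = 0
root (node _ k _) = k

depth : Tree → ℕ → ℕ
depth leaf x = 0
depth (node l k r) x =
  if x <ᵇ k then suc (depth l x)
  else if k <ᵇ x then suc (depth r x)
  else 0

lca : Tree → ℕ → ℕ → ℕ
lca leaf x y = 0
lca (node l k r) x y =
  if (x <ᵇ k) ∧ (y <ᵇ k) then lca l x y
  else if (k <ᵇ x) ∧ (k <ᵇ y) then lca r x y
  else k

rdist : Tree → ℕ → ℕ → ℕ
rdist T i j = depth T i + depth T j ∸ 2 * depth T (lca T i j)

steps : Tree → List ℕ → List (ℕ × ℕ)
steps T X = zip (root T ∷ X) X

cost : Tree → List ℕ → ℕ
cost T X = sum (map (λ p → rdist T (Data.Product.proj₁ p) (Data.Product.proj₂ p)) (steps T X))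

-- Σ_{k=a}^{b} w_k  (for a ≤ b)
rangeSum : (ℕ → ℕ) → ℕ → ℕ → ℕ
rangeSum w a b = sum (map (λ t → w (a + t)) (upTo (suc (b ∸ a))))

numer : (ℕ → ℕ) → ℕ × ℕ → ℕ
numer w (x , y) = rangeSum w (x ⊓ y) (x ⊔ y)

denom : (ℕ → ℕ) → ℕ × ℕ → ℕ
denom w (x , y) = w x ⊓ w y

module Submission where

-- Lower bound for static binary search trees, stated with integer weights:
-- for a BST T of height H put  w(x) = 4 ^ (H ∸ d_T(x)).  For one search
-- step x < y, every key of [x, y] lies in the subtree rooted at
-- v = LCA_T(x, y), and the weights in a subtree whose root has weight 4^D
-- add up to at most 2·4^D (a geometric series, one level at a time).  As
-- w(x) ≥ 4^D / 4^(d(x) - d(v)) and likewise for y, the ratio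
--   Σ_{k=x}^{y} w_k / min(w_x, w_y)  is at most  2 · 4^(r(T,x,y)) ≤ 8^(r(T,x,y))  (r ≥ 1 as x ≠ y),
-- i.e. lg of it is at most 3·r(T,x,y); multiplying over all steps gives the
-- theorem with C = 3.

open import Defs
open import Data.Nat using (ℕ; _+_; _*_; _^_; _≤_)
open import Data.List using (List; map)
open import Data.Nat.ListAction using (product)
open import Data.List.Relation.Unary.All using (All)
open import Data.Product using (Σ; _×_)

open import Data.Nat.Base using (zero; suc; _∸_; _<_; _<ᵇ_; _⊓_; _⊔_; z≤n; s≤s)
open import Data.Nat.Properties
open import Data.Bool using (true; false; T)
open import Data.Bool.Properties using (∧-comm; ∧-zeroʳ; T-≡)
open import Data.List using ([]; _∷_; _++_; applyUpTo; upTo; zip)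
open import Data.List.Properties using (map-upTo)
open import Data.Nat.ListAction using (sum)
open import Data.List.Relation.Unary.All using ([]; _∷_)
import Data.List.Relation.Unary.All as All
open import Data.Product using (_,_; proj₁; proj₂)
open import Data.Empty using (⊥-elim)
open import Data.Sum using (inj₁; inj₂)
open import Function using (_∘_)
open import Function.Bundles using (Equivalence)
open import Relation.Binary using (tri<; tri≈; tri>)
open import Relation.Binary.PropositionalEquality
open import Relation.Nullary using (yes; no)
open import Data.Nat.Tactic.RingSolver using (solve-∀)

<ᵇ-true : ∀ {m n} → m < n → (m <ᵇ n) ≡ true
<ᵇ-true m<n = Equivalence.to T-≡ (<⇒<ᵇ m<n)

<ᵇ-false : ∀ {m n} → n ≤ m → (m <ᵇ n) ≡ false
<ᵇ-false {m} {n} n≤m with m <ᵇ n in eq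
... | false = refl
... | true  = ⊥-elim (<⇒≱ (<ᵇ⇒< m n (subst T (sym eq) _)) n≤m)

segSum : (ℕ → ℕ) → ℕ → ℕ → ℕ
segSum w a zero    = 0
segSum w a (suc n) = w a + segSum w (suc a) n

sum-applyUpTo : ∀ w a n (g : ℕ → ℕ) → (∀ t → g t ≡ w (a + t)) →
  sum (applyUpTo g n) ≡ segSum w a n
sum-applyUpTo w a zero    g g≗ = refl
sum-applyUpTo w a (suc n) g g≗ =
  cong₂ _+_ (trans (g≗ 0) (cong w (+-identityʳ a)))
            (sum-applyUpTo w (suc a) n (g ∘ suc) (λ t → trans (g≗ (suc t)) (cong w (+-suc a t))))

rangeSum-segSum : ∀ w a b → rangeSum w a b ≡ segSum w a (suc (b ∸ a))
rangeSum-segSum w a b =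
  trans (cong sum (map-upTo (λ t → w (a + t)) (suc (b ∸ a))))
        (sum-applyUpTo w a (suc (b ∸ a)) (λ t → w (a + t)) (λ t → refl))

segSum-split : ∀ w a p q → segSum w a (p + q) ≡ segSum w a p + segSum w (a + p) q
segSum-split w a zero    q rewrite +-identityʳ a = refl
segSum-split w a (suc p) q rewrite segSum-split w (suc a) p q | +-suc a p =
  sym (+-assoc (w a) _ _)

segSum-prefix : ∀ w a {m N} → m ≤ N → segSum w a m ≤ segSum w a N
segSum-prefix w a {zero}  z≤n     = z≤n
segSum-prefix w a {suc m} (s≤s p) = +-monoʳ-≤ (w a) (segSum-prefix w (suc a) p)

segSum-sub : ∀ w lo p m N → p + m ≤ N → segSum w (lo + p) m ≤ segSum w lo N
segSum-sub w lo zero    m N       q rewrite +-identityʳ lo = segSum-prefix w lo q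
segSum-sub w lo (suc p) m (suc N) (s≤s q) rewrite +-suc lo p =
  ≤-trans (segSum-sub w (suc lo) p m N q) (m≤n+m _ (w lo))

segSum-cong : ∀ w v a n b → (∀ z → a ≤ z → z < b → w z ≡ v z) → a + n ≤ b →
  segSum w a n ≡ segSum v a n
segSum-cong w v a zero    b w≗v q = refl
segSum-cong w v a (suc n) b w≗v q =
  cong₂ _+_ (w≗v a ≤-refl (≤-trans (s≤s (m≤m+n a n)) q′))
            (segSum-cong w v (suc a) n b (λ z a<z z<b → w≗v z (≤-trans (n≤1+n a) a<z) z<b) q′)
  where
  q′ : suc a + n ≤ b
  q′ = subst (_≤ b) (+-suc a n) q

window-end : ∀ {x y} → x ≤ y → x + suc (y ∸ x) ≡ suc y
window-end {x} {y} x≤y = trans (+-suc x (y ∸ x)) (cong suc (m+[n∸m]≡n x≤y))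

window-bound : ∀ w {lo hi x y} → lo ≤ x → x ≤ y → y < hi →
  segSum w x (suc (y ∸ x)) ≤ segSum w lo (hi ∸ lo)
window-bound w {lo} {hi} {x} {y} lo≤x x≤y y<hi = begin
    segSum w x (suc (y ∸ x))          ≡⟨ cong (λ z → segSum w z (suc (y ∸ x))) (sym (m+[n∸m]≡n lo≤x)) ⟩
    segSum w (lo + (x ∸ lo)) (suc (y ∸ x)) ≤⟨ segSum-sub w lo (x ∸ lo) (suc (y ∸ x)) (hi ∸ lo) fits ⟩
    segSum w lo (hi ∸ lo)              ∎
  where
  open ≤-Reasoning
  ends : lo + ((x ∸ lo) + suc (y ∸ x)) ≡ suc y
  ends = trans (sym (+-assoc lo _ _))
               (trans (cong (_+ suc (y ∸ x)) (m+[n∸m]≡n lo≤x)) (window-end x≤y))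
  fits : (x ∸ lo) + suc (y ∸ x) ≤ hi ∸ lo
  fits = ≤-trans (≤-reflexive (sym (m+n∸m≡n lo _)))
                 (∸-monoˡ-≤ lo (≤-trans (≤-reflexive ends) y<hi))

segSum-node : ∀ w {lo k hi} → lo ≤ k → suc k ≤ hi →
  segSum w lo (hi ∸ lo) ≡ segSum w lo (k ∸ lo) + (w k + segSum w (suc k) (hi ∸ suc k))
segSum-node w {lo} {k} {hi} lo≤k k<hi = begin
    segSum w lo (hi ∸ lo)                          ≡⟨ cong (segSum w lo) length-split ⟩
    segSum w lo ((k ∸ lo) + suc (hi ∸ suc k))      ≡⟨ segSum-split w lo (k ∸ lo) _ ⟩
    segSum w lo (k ∸ lo) + segSum w (lo + (k ∸ lo)) (suc (hi ∸ suc k))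
      ≡⟨ cong (λ z → segSum w lo (k ∸ lo) + segSum w z (suc (hi ∸ suc k))) (m+[n∸m]≡n lo≤k) ⟩
    segSum w lo (k ∸ lo) + (w k + segSum w (suc k) (hi ∸ suc k)) ∎
  where
  open ≡-Reasoning
  length-split : hi ∸ lo ≡ (k ∸ lo) + suc (hi ∸ suc k)
  length-split = begin
    hi ∸ lo                                   ≡⟨ cong (_∸ lo) (sym (m+[n∸m]≡n k<hi)) ⟩
    suc k + (hi ∸ suc k) ∸ lo                 ≡⟨ cong (_∸ lo) (sym (+-suc k _)) ⟩
    k + suc (hi ∸ suc k) ∸ lo                 ≡⟨ +-∸-comm _ lo≤k ⟩
    (k ∸ lo) + suc (hi ∸ suc k)               ∎

-- BST lo hi t: t is a search tree whose in-order keys are lo, lo+1, ..., hi-1.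
data BST : ℕ → ℕ → Tree → Set where
  bleaf : ∀ {lo} → BST lo lo leaf
  bnode : ∀ {lo k hi l r} → BST lo k l → BST (suc k) hi r → BST lo hi (node l k r)

bst-≤ : ∀ {lo hi t} → BST lo hi t → lo ≤ hi
bst-≤ bleaf       = ≤-refl
bst-≤ (bnode l r) = ≤-trans (bst-≤ l) (≤-trans (n≤1+n _) (bst-≤ r))

data Consecutive : ℕ → ℕ → List ℕ → Set where
  cnil  : ∀ {lo} → Consecutive lo lo []
  ccons : ∀ {lo hi xs} → Consecutive (suc lo) hi xs → Consecutive lo hi (lo ∷ xs)

consecutive-split : ∀ xs {lo hi k ys} → Consecutive lo hi (xs ++ k ∷ ys) →
  Consecutive lo k xs × Consecutive (suc k) hi ys
consecutive-split []       (ccons c) = cnil , c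
consecutive-split (x ∷ xs) (ccons c) with consecutive-split xs c
... | left , right = ccons left , right

consecutive-suc : ∀ {a b xs} → Consecutive a b xs → Consecutive (suc a) (suc b) (map suc xs)
consecutive-suc cnil      = cnil
consecutive-suc (ccons c) = ccons (consecutive-suc c)

consecutive-upTo : ∀ n → Consecutive 0 n (upTo n)
consecutive-upTo zero    = cnil
consecutive-upTo (suc n) =
  ccons (subst (Consecutive 1 (suc n)) (map-upTo suc n) (consecutive-suc (consecutive-upTo n)))

consecutive⇒BST : ∀ t {lo hi} → Consecutive lo hi (inorder t) → BST lo hi t
consecutive⇒BST leaf         cnil = bleaf
consecutive⇒BST (node l k r) c with consecutive-split (inorder l) c
... | cl , cr = bnode (consecutive⇒BST l cl) (consecutive⇒BST r cr)

IsBSTOn⇒BST : ∀ n T → IsBSTOn n T → BST 1 (suc n) T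
IsBSTOn⇒BST n T eq =
  consecutive⇒BST T (subst (Consecutive 1 (suc n)) (sym eq) (consecutive-suc (consecutive-upTo n)))

module AtNode {l r : Tree} {k : ℕ} where
  depth-left : ∀ {z} → z < k → depth (node l k r) z ≡ suc (depth l z)
  depth-left z<k rewrite <ᵇ-true z<k = refl

  depth-right : ∀ {z} → k < z → depth (node l k r) z ≡ suc (depth r z)
  depth-right k<z rewrite <ᵇ-false (<⇒≤ k<z) | <ᵇ-true k<z = refl

  depth-root : depth (node l k r) k ≡ 0
  depth-root rewrite <ᵇ-false (≤-refl {k}) = refl

  lca-left : ∀ {x y} → x < k → y < k → lca (node l k r) x y ≡ lca l x y
  lca-left x<k y<k rewrite <ᵇ-true x<k | <ᵇ-true y<k = refl

  lca-right : ∀ {x y} → k < x → k < y → lca (node l k r) x y ≡ lca r x y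
  lca-right k<x k<y
    rewrite <ᵇ-false (<⇒≤ k<x) | <ᵇ-true k<x | <ᵇ-true k<y = refl

  lca-root : ∀ {x y} → x ≤ k → k ≤ y → lca (node l k r) x y ≡ k
  lca-root {x} x≤k k≤y rewrite <ᵇ-false k≤y | ∧-zeroʳ (x <ᵇ k) | <ᵇ-false x≤k = refl

open AtNode

-- If s sits one level below the root of t and has the same LCA of x and y,
-- then r(t, x, y) = r(s, x, y): the common extra edge cancels.
rdist-shift : ∀ {t s x y} → lca t x y ≡ lca s x y →
  depth t x ≡ suc (depth s x) → depth t y ≡ suc (depth s y) →
  depth t (lca s x y) ≡ suc (depth s (lca s x y)) → rdist t x y ≡ rdist s x y
rdist-shift {t} {s} {x} {y} eqv eqx eqy eqc rewrite eqv | eqx | eqy | eqc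
  | +-suc (depth s x) (depth s y) | +-suc (depth s (lca s x y)) (depth s (lca s x y) + 0) = refl

lca-comm : ∀ t x y → lca t x y ≡ lca t y x
lca-comm leaf         x y = refl
lca-comm (node l k r) x y
  rewrite ∧-comm (x <ᵇ k) (y <ᵇ k) | ∧-comm (k <ᵇ x) (k <ᵇ y) | lca-comm l x y | lca-comm r x y = refl

rdist-comm : ∀ t x y → rdist t x y ≡ rdist t y x
rdist-comm t x y rewrite lca-comm t x y | +-comm (depth t x) (depth t y) = refl

lca-between : ∀ {lo hi t x y} → BST lo hi t → lo ≤ x → x ≤ y → y < hi →
  x ≤ lca t x y × lca t x y ≤ y
lca-between bleaf lo≤x x≤y y<hi = ⊥-elim (<⇒≱ (≤-<-trans lo≤x (≤-<-trans x≤y y<hi)) ≤-refl)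
lca-between {t = node l k r} {x} {y} (bnode bl br) lo≤x x≤y y<hi with <-cmp y k
... | tri< y<k _ _ rewrite lca-left {l} {r} (≤-<-trans x≤y y<k) y<k = lca-between bl lo≤x x≤y y<k
... | tri≈ _ refl _ rewrite lca-root {l} {r} x≤y (≤-refl {y}) = x≤y , ≤-refl
... | tri> _ _ k<y with <-cmp k x
...   | tri< k<x _ _ rewrite lca-right {l} {r} k<x k<y = lca-between br k<x x≤y y<hi
...   | tri≈ _ refl _ rewrite lca-root {l} {r} (≤-refl {x}) (<⇒≤ k<y) = ≤-refl , <⇒≤ k<y
...   | tri> _ _ x<k rewrite lca-root {l} {r} (<⇒≤ x<k) (<⇒≤ k<y) = <⇒≤ x<k , <⇒≤ k<y

rdist-left : ∀ {lo l k r x y} → BST lo k l → lo ≤ x → x ≤ y → y < k →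
  rdist (node l k r) x y ≡ rdist l x y
rdist-left {l = l} {k} {r} bl lo≤x x≤y y<k = rdist-shift {node l k r} {l} (lca-left {l} {r} x<k y<k)
  (depth-left {l} {r} x<k) (depth-left {l} {r} y<k) (depth-left {l} {r} v<k)
  where
  x<k = ≤-<-trans x≤y y<k
  v<k = ≤-<-trans (proj₂ (lca-between bl lo≤x x≤y y<k)) y<k

rdist-right : ∀ {hi l k r x y} → BST (suc k) hi r → k < x → x ≤ y → y < hi →
  rdist (node l k r) x y ≡ rdist r x y
rdist-right {l = l} {k} {r} br k<x x≤y y<hi = rdist-shift {node l k r} {r} (lca-right {l} {r} k<x k<y)
  (depth-right {l} {r} k<x) (depth-right {l} {r} k<y) (depth-right {l} {r} k<v)
  where
  k<y = <-≤-trans k<x x≤y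
  k<v = <-≤-trans k<x (proj₁ (lca-between br k<x x≤y y<hi))

rdist-root : ∀ {l k r x y} → x ≤ k → k ≤ y →
  rdist (node l k r) x y ≡ depth (node l k r) x + depth (node l k r) y
rdist-root {l} {k} {r} x≤k k≤y rewrite lca-root {l} {r} x≤k k≤y | depth-root {l} {r} {k} = refl

straddle-depth : ∀ {l k r x y} → x < y → x ≤ k → k ≤ y →
  1 ≤ depth (node l k r) x + depth (node l k r) y
straddle-depth {l} {k} {r} {x} {y} x<y x≤k k≤y with m≤n⇒m<n∨m≡n x≤k
... | inj₁ x<k rewrite depth-left {l} {r} x<k = s≤s z≤n
... | inj₂ refl rewrite depth-right {l} {r} x<y = ≤-trans (s≤s z≤n) (m≤n+m _ (depth (node l k r) x))

data Position (k x y : ℕ) : Set where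
  left     : y < k → Position k x y
  right    : k < x → Position k x y
  straddle : x ≤ k → k ≤ y → Position k x y

position : ∀ k x y → Position k x y
position k x y with y <? k | k <? x
... | yes y<k | _       = left y<k
... | no _    | yes k<x = right k<x
... | no y≮k  | no k≮x  = straddle (≮⇒≥ k≮x) (≮⇒≥ y≮k)

-- Height (number of levels); the weights are scaled by any bound D on it.
height : Tree → ℕ
height leaf         = 0
height (node l k r) = suc (height l ⊔ height r)

height-left : ∀ {l k r D} → height (node l k r) ≤ suc D → height l ≤ D
height-left {l} {k} {r} (s≤s h) = m⊔n≤o⇒m≤o (height l) (height r) h

height-right : ∀ {l k r D} → height (node l k r) ≤ suc D → height r ≤ D
height-right {l} {k} {r} (s≤s h) = m⊔n≤o⇒n≤o (height l) (height r) h

weight : ℕ → Tree → ℕ → ℕ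
weight D t x = 4 ^ (D ∸ depth t x)

weight-positive : ∀ D t x → 1 ≤ weight D t x
weight-positive D t x = m^n>0 4 (D ∸ depth t x)

weight-lower : ∀ D t x → 4 ^ D ≤ 4 ^ depth t x * weight D t x
weight-lower D t x = ≤-trans (^-monoʳ-≤ 4 (m≤n+m∸n D (depth t x)))
                             (≤-reflexive (^-distribˡ-+-* 4 (depth t x) (D ∸ depth t x)))

weight-left : ∀ {l k r D z} → z < k → weight (suc D) (node l k r) z ≡ weight D l z
weight-left {l} {k} {r} {D} z<k = cong (λ d → 4 ^ (suc D ∸ d)) (depth-left {l} {r} z<k)

weight-right : ∀ {l k r D z} → k < z → weight (suc D) (node l k r) z ≡ weight D r z
weight-right {l} {k} {r} {D} k<z = cong (λ d → 4 ^ (suc D ∸ d)) (depth-right {l} {r} k<z)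

weight-root : ∀ {l k r D} → weight D (node l k r) k ≡ 4 ^ D
weight-root {l} {k} {r} {D} = cong (λ d → 4 ^ (D ∸ d)) (depth-root {l} {r} {k})

-- A subtree whose root has weight 4^D carries total weight at most 2·4^D:
-- each child subtree carries at most 2·4^(D-1) and 2·4^(D-1)·2 + 4^D = 2·4^D.
subtree-sum : ∀ {lo hi t} D → BST lo hi t → height t ≤ D →
  segSum (weight D t) lo (hi ∸ lo) ≤ 2 * 4 ^ D
subtree-sum {lo} D bleaf h rewrite n∸n≡0 lo = z≤n
subtree-sum {lo} {hi} {node l k r} (suc D) (bnode bl br) h = begin
    segSum w lo (hi ∸ lo)
      ≡⟨ segSum-node w (bst-≤ bl) (bst-≤ br) ⟩
    segSum w lo (k ∸ lo) + (w k + segSum w (suc k) (hi ∸ suc k))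
      ≡⟨ cong₂ _+_ left-part (cong₂ _+_ (weight-root {l} {k} {r}) right-part) ⟩
    segSum (weight D l) lo (k ∸ lo) + (4 ^ suc D + segSum (weight D r) (suc k) (hi ∸ suc k))
      ≤⟨ +-mono-≤ (subtree-sum D bl (height-left {l} {k} {r} h))
                  (+-monoʳ-≤ (4 ^ suc D) (subtree-sum D br (height-right {l} {k} {r} h))) ⟩
    2 * 4 ^ D + (4 ^ suc D + 2 * 4 ^ D)
      ≡⟨ geometric (4 ^ D) ⟩
    2 * 4 ^ suc D ∎
  where
  open ≤-Reasoning
  w : ℕ → ℕ
  w = weight (suc D) (node l k r)
  left-part : segSum w lo (k ∸ lo) ≡ segSum (weight D l) lo (k ∸ lo)
  left-part = segSum-cong w (weight D l) lo (k ∸ lo) k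
    (λ z _ z<k → weight-left {l} {k} {r} z<k) (≤-reflexive (m+[n∸m]≡n (bst-≤ bl)))
  right-part : segSum w (suc k) (hi ∸ suc k) ≡ segSum (weight D r) (suc k) (hi ∸ suc k)
  right-part = segSum-cong w (weight D r) (suc k) (hi ∸ suc k) hi
    (λ z k<z _ → weight-right {l} {k} {r} k<z) (≤-reflexive (m+[n∸m]≡n (bst-≤ br)))
  geometric : ∀ u → 2 * u + (4 * u + 2 * u) ≡ 2 * (4 * u)
  geometric = solve-∀

ratio-bound : ∀ D dx dy wx wy → 4 ^ D ≤ 4 ^ dx * wx → 4 ^ D ≤ 4 ^ dy * wy → 1 ≤ dx + dy →
  2 * 4 ^ D ≤ 2 ^ (3 * (dx + dy)) * (wx ⊓ wy)
ratio-bound D dx dy wx wy lower-x lower-y s≥1 = begin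
    2 * 4 ^ D                  ≤⟨ *-monoʳ-≤ 2 lower-min ⟩
    2 * (4 ^ s * (wx ⊓ wy))    ≡⟨ sym (*-assoc 2 (4 ^ s) _) ⟩
    2 * 4 ^ s * (wx ⊓ wy)      ≡⟨ cong (λ z → 2 * z * (wx ⊓ wy)) (^-*-assoc 2 2 s) ⟩
    2 ^ suc (2 * s) * (wx ⊓ wy) ≤⟨ *-monoˡ-≤ (wx ⊓ wy) (^-monoʳ-≤ 2 (+-monoˡ-≤ (2 * s) s≥1)) ⟩
    2 ^ (3 * s) * (wx ⊓ wy)    ∎
  where
  open ≤-Reasoning
  s = dx + dy
  lower-min : 4 ^ D ≤ 4 ^ s * (wx ⊓ wy)
  lower-min = ≤-trans
    (⊓-glb (≤-trans lower-x (*-monoˡ-≤ wx (^-monoʳ-≤ 4 (m≤m+n dx dy))))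
           (≤-trans lower-y (*-monoˡ-≤ wy (^-monoʳ-≤ 4 (m≤n+m dy dx)))))
    (≤-reflexive (sym (*-distribˡ-⊓ (4 ^ s) wx wy)))

-- A window bound carries over to weights that agree on the window and to an
-- equal distance; this moves the bound from a subtree up to the whole tree.
bound-transfer : ∀ {w v x y ρ ρ′} → x ≤ y → (∀ z → x ≤ z → z ≤ y → w z ≡ v z) → ρ ≡ ρ′ →
  segSum w x (suc (y ∸ x)) ≤ 2 ^ (3 * ρ) * (w x ⊓ w y) →
  segSum v x (suc (y ∸ x)) ≤ 2 ^ (3 * ρ′) * (v x ⊓ v y)
bound-transfer {w} {v} {x} {y} {ρ} x≤y w≗v refl bound = begin
    segSum v x (suc (y ∸ x))   ≡⟨ sym (segSum-cong w v x (suc (y ∸ x)) (suc y)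
                                   (λ z x≤z z<1+y → w≗v z x≤z (≤-pred z<1+y)) (≤-reflexive (window-end x≤y))) ⟩
    segSum w x (suc (y ∸ x))   ≤⟨ bound ⟩
    2 ^ (3 * ρ) * (w x ⊓ w y)  ≡⟨ cong (λ m → 2 ^ (3 * ρ) * m) (cong₂ _⊓_ (w≗v x ≤-refl x≤y) (w≗v y x≤y ≤-refl)) ⟩
    2 ^ (3 * ρ) * (v x ⊓ v y)  ∎
  where open ≤-Reasoning

-- When the root k of t lies in [x, y]: the window lies inside t, whose total
-- weight is at most 2·4^D, and r(t, x, y) = d(x) + d(y) ≥ 1.
straddle-bound : ∀ {lo hi l k r x y} D → BST lo hi (node l k r) → height (node l k r) ≤ D →
  lo ≤ x → x < y → y < hi → x ≤ k → k ≤ y →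
  segSum (weight D (node l k r)) x (suc (y ∸ x))
    ≤ 2 ^ (3 * rdist (node l k r) x y) * (weight D (node l k r) x ⊓ weight D (node l k r) y)
straddle-bound {lo} {hi} {l} {k} {r} {x} {y} D b h lo≤x x<y y<hi x≤k k≤y = begin
    segSum w x (suc (y ∸ x))  ≤⟨ window-bound w lo≤x (<⇒≤ x<y) y<hi ⟩
    segSum w lo (hi ∸ lo)     ≤⟨ subtree-sum D b h ⟩
    2 * 4 ^ D                 ≤⟨ ratio-bound D (depth t x) (depth t y) (w x) (w y)
                                   (weight-lower D t x) (weight-lower D t y) (straddle-depth {l} {k} {r} x<y x≤k k≤y) ⟩
    2 ^ (3 * (depth t x + depth t y)) * (w x ⊓ w y)
                              ≡⟨ cong (λ ρ → 2 ^ (3 * ρ) * (w x ⊓ w y)) (sym (rdist-root {l} {k} {r} x≤k k≤y)) ⟩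
    2 ^ (3 * rdist t x y) * (w x ⊓ w y) ∎
  where
  open ≤-Reasoning
  t = node l k r
  w = weight D t

-- Descend while x and y lie on the same side of the root; at their LCA use straddle-bound.
range-bound : ∀ {lo hi t x y} D → BST lo hi t → height t ≤ D → lo ≤ x → x < y → y < hi →
  segSum (weight D t) x (suc (y ∸ x)) ≤ 2 ^ (3 * rdist t x y) * (weight D t x ⊓ weight D t y)
range-bound D bleaf h lo≤x x<y y<hi = ⊥-elim (<⇒≱ (≤-<-trans lo≤x (<-trans x<y y<hi)) ≤-refl)
range-bound {t = node l k r} {x} {y} (suc D) (bnode bl br) h lo≤x x<y y<hi with position k x y
... | left y<k = bound-transfer {weight D l} (<⇒≤ x<y)
        (λ z _ z≤y → sym (weight-left {l} {k} {r} (≤-<-trans z≤y y<k)))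
        (sym (rdist-left {r = r} bl lo≤x (<⇒≤ x<y) y<k))
        (range-bound D bl (height-left {l} {k} {r} h) lo≤x x<y y<k)
... | right k<x = bound-transfer {weight D r} (<⇒≤ x<y)
        (λ z x≤z _ → sym (weight-right {l} {k} {r} (<-≤-trans k<x x≤z)))
        (sym (rdist-right {l = l} br k<x (<⇒≤ x<y) y<hi))
        (range-bound D br (height-right {l} {k} {r} h) k<x x<y y<hi)
... | straddle x≤k k≤y = straddle-bound (suc D) (bnode bl br) h lo≤x x<y y<hi x≤k k≤y

ordered-pair-bound : ∀ {lo hi t} D → BST lo hi t → height t ≤ D → ∀ {x y} →
  lo ≤ x → x < y → y < hi →
  numer (weight D t) (x , y) ≤ 2 ^ (3 * rdist t x y) * denom (weight D t) (x , y)
ordered-pair-bound {t = t} D b h {x} {y} lo≤x x<y y<hi = begin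
    rangeSum w (x ⊓ y) (x ⊔ y)
      ≡⟨ cong₂ (rangeSum w) (m≤n⇒m⊓n≡m (<⇒≤ x<y)) (m≤n⇒m⊔n≡n (<⇒≤ x<y)) ⟩
    rangeSum w x y                      ≡⟨ rangeSum-segSum w x y ⟩
    segSum w x (suc (y ∸ x))            ≤⟨ range-bound D b h lo≤x x<y y<hi ⟩
    2 ^ (3 * rdist t x y) * (w x ⊓ w y) ∎
  where
  open ≤-Reasoning
  w = weight D t

diagonal-bound : ∀ (w : ℕ → ℕ) x ρ → numer w (x , x) ≤ 2 ^ ρ * denom w (x , x)
diagonal-bound w x ρ = begin
    rangeSum w (x ⊓ x) (x ⊔ x)  ≡⟨ cong₂ (rangeSum w) (⊓-idem x) (⊔-idem x) ⟩
    rangeSum w x x              ≡⟨ rangeSum-segSum w x x ⟩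
    segSum w x (suc (x ∸ x))    ≡⟨ cong (λ m → segSum w x (suc m)) (n∸n≡0 x) ⟩
    w x + 0                     ≡⟨ +-identityʳ (w x) ⟩
    w x                         ≤⟨ m≤n*m (w x) (2 ^ ρ) {{m^n≢0 2 ρ}} ⟩
    2 ^ ρ * w x                 ≡⟨ cong (2 ^ ρ *_) (sym (⊓-idem (w x))) ⟩
    2 ^ ρ * (w x ⊓ w x)         ∎
  where open ≤-Reasoning

swap-bound : ∀ (w : ℕ → ℕ) t x y →
  numer w (y , x) ≤ 2 ^ (3 * rdist t y x) * denom w (y , x) →
  numer w (x , y) ≤ 2 ^ (3 * rdist t x y) * denom w (x , y)
swap-bound w t x y bound = begin
    rangeSum w (x ⊓ y) (x ⊔ y)            ≡⟨ cong₂ (rangeSum w) (⊓-comm x y) (⊔-comm x y) ⟩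
    rangeSum w (y ⊓ x) (y ⊔ x)            ≤⟨ bound ⟩
    2 ^ (3 * rdist t y x) * (w y ⊓ w x)   ≡⟨ cong₂ (λ ρ m → 2 ^ (3 * ρ) * m) (rdist-comm t y x) (⊓-comm (w y) (w x)) ⟩
    2 ^ (3 * rdist t x y) * (w x ⊓ w y)   ∎
  where open ≤-Reasoning

InInterval : ℕ → ℕ → ℕ → Set
InInterval lo hi x = lo ≤ x × x < hi

pair-bound : ∀ {lo hi t} D → BST lo hi t → height t ≤ D → ∀ {x y} →
  InInterval lo hi x → InInterval lo hi y →
  numer (weight D t) (x , y) ≤ 2 ^ (3 * rdist t x y) * denom (weight D t) (x , y)
pair-bound {t = t} D b h {x} {y} (lo≤x , x<hi) (lo≤y , y<hi) with <-cmp x y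
... | tri< x<y _ _  = ordered-pair-bound D b h lo≤x x<y y<hi
... | tri≈ _ refl _ = diagonal-bound (weight D t) x (3 * rdist t x x)
... | tri> _ _ y<x  = swap-bound (weight D t) t x y (ordered-pair-bound D b h lo≤y y<x x<hi)

product-bound : ∀ {A : Set} C (a b f : A → ℕ) (ps : List A) →
  All (λ p → a p ≤ 2 ^ (C * f p) * b p) ps →
  product (map a ps) ≤ 2 ^ (C * sum (map f ps)) * product (map b ps)
product-bound C a b f []       []             = ≤-reflexive (cong (λ e → 2 ^ e * 1) (sym (*-zeroʳ C)))
product-bound C a b f (p ∷ ps) (bound ∷ bounds) = begin
    a p * product (map a ps)
      ≤⟨ *-mono-≤ bound (product-bound C a b f ps bounds) ⟩
    (2 ^ (C * f p) * b p) * (2 ^ (C * S) * B)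
      ≡⟨ interchange (2 ^ (C * f p)) (b p) (2 ^ (C * S)) B ⟩
    (2 ^ (C * f p) * 2 ^ (C * S)) * (b p * B)
      ≡⟨ cong (_* (b p * B)) (sym (^-distribˡ-+-* 2 (C * f p) (C * S))) ⟩
    2 ^ (C * f p + C * S) * (b p * B)
      ≡⟨ cong (λ e → 2 ^ e * (b p * B)) (sym (*-distribˡ-+ C (f p) S)) ⟩
    2 ^ (C * (f p + S)) * (b p * B) ∎
  where
  open ≤-Reasoning
  S = sum (map f ps)
  B = product (map b ps)
  interchange : ∀ u v u′ v′ → (u * v) * (u′ * v′) ≡ (u * u′) * (v * v′)
  interchange = solve-∀

zip-pairs : ∀ {P : ℕ → Set} {x₀} X → P x₀ → All P X →
  All (λ p → P (proj₁ p) × P (proj₂ p)) (zip (x₀ ∷ X) X)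
zip-pairs []      p₀ []       = []
zip-pairs (x ∷ X) p₀ (p ∷ ps) = (p₀ , p) ∷ zip-pairs X p ps

root-inInterval : ∀ {lo hi T} → BST lo hi T → lo < hi → InInterval lo hi (root T)
root-inInterval bleaf         lo<lo = ⊥-elim (<-irrefl refl lo<lo)
root-inInterval (bnode bl br) _     = bst-≤ bl , bst-≤ br

steps-inInterval : ∀ {lo hi T X} → BST lo hi T → All (InInterval lo hi) X →
  All (λ p → InInterval lo hi (proj₁ p) × InInterval lo hi (proj₂ p)) (steps T X)
steps-inInterval {X = []}    b []  = []
steps-inInterval {X = x ∷ X} b x∈X@((lo≤x , x<hi) ∷ _) =
  zip-pairs (x ∷ X) (root-inInterval b (≤-<-trans lo≤x x<hi)) x∈X

cost-bound : ∀ {lo hi T X} → BST lo hi T → All (InInterval lo hi) X →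
  product (map (numer (weight (height T) T)) (steps T X))
    ≤ 2 ^ (3 * cost T X) * product (map (denom (weight (height T) T)) (steps T X))
cost-bound {T = T} {X} b X∈ =
  product-bound 3 (numer w) (denom w) (λ p → rdist T (proj₁ p) (proj₂ p)) (steps T X)
    (All.map (λ (x∈ , y∈) → pair-bound (height T) b ≤-refl x∈ y∈) (steps-inInterval b X∈))
  where
  w = weight (height T) T

corollary2 : Σ ℕ λ C → (n : ℕ) (T : Tree) → IsBSTOn n T →
    (X : List ℕ) → All (λ x → 1 ≤ x × x ≤ n) X →
    Σ (ℕ → ℕ) λ w → ((k : ℕ) → 1 ≤ k → k ≤ n → 1 ≤ w k) ×
      (product (map (numer w) (steps T X))
        ≤ 2 ^ (C * cost T X) * product (map (denom w) (steps T X)))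
corollary2 = 3 , λ n T isBST X X∈ →
    weight (height T) T
  , (λ k _ _ → weight-positive (height T) T k)
  , cost-bound (IsBSTOn⇒BST n T isBST) (All.map (λ (1≤x , x≤n) → 1≤x , s≤s x≤n) X∈)
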